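{- Let $G$ be a long-refinement graph with $\deg(G) = \{2,3\}$ such that there is an $i \in \mathbb{N}_0$ for which every class of $\pi^i_G$ has exactly two elements, and let $\prec$ be the splitting order of the pairs. Let $P_1$ be a pair. Then exactly one of the following holds. (a) $P_1 \neq \min(\prec)$ and for every pair $P_2$ with $S(P_1) \prec P_2$, it holds that $E(G[P_1,P_2]) = \emptyset$. (b) $P_1 = \min(\prec)$ and there are exactly two pairs $P_2, P'_2$ among the pairs $P'$ with $S(P_1) \prec P'$ such that $E(G[P_1,P']) \neq \emptyset$; furthermore, there is a vertex $v_1 \in P_1$ such that $G[\{v_1\}, P_2]$ and $G[P_1 \setminus \{v_1\}, P'_2]$ are complete bipartite and $E(G[\{v_1\},P'_2]) = E(G[P_1 \setminus \{v_1\}, P_2]) = \emptyset$.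
   Context: All graphs are finite, simple, undirected, with monochromatic initial colouring. Colour Refinement computes $\chi^0_G$ constant and $\chi^i_G(v) = \big(\chi^{i-1}_G(v), \{\!\{\chi^{i-1}_G(w) \mid w \in N(v)\}\!\}\big)$; $\pi^i_G$ is the partition of $V(G)$ into colour classes of $\chi^i_G$, and $\mathrm{WL}_1(G)$ is the least $j \geq 0$ with $\pi^j_G = \pi^{j+1}_G$. A long-refinement graph is a graph $G$ with $\mathrm{WL}_1(G) = |G|-1$; $\deg(G) = \{\deg(v) \mid v \in V(G)\}$. In the setting of the claim, the pairs are the elements of $\pi^i_G$; each pair is eventually split into two singletons, and distinct pairs are split in distinct iterations. The splitting order $\prec$ is the linear order on the pairs with $P \prec P'$ iff $P$ is split into singletons in an earlier iteration than $P'$; $\min(\prec)$ is its least pair and $S(P)$ denotes the successor of $P$ in $\prec$ (if $P$ is the maximum, no pair $P_2$ satisfies $S(P) \prec P_2$). For vertex sets $A,B$, $G[A,B]$ is the graph with vertex set $A \cup B$ whose edges are the edges of $G$ with one endpoint in $A$ and the other in $B$, and $E(\cdot)$ denotes the edge set. -}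

module Defs where

open import Data.Nat using (ℕ; zero; suc; _+_; _≡ᵇ_; _<_; _∸_)
open import Data.Bool using (Bool; true; false; _∧_; if_then_else_)
open import Data.Fin using (Fin; zero; suc)
open import Data.Product using (Σ; _×_; _,_; ∃; ∃-syntax)
open import Data.Sum using (_⊎_)
open import Relation.Binary.PropositionalEquality using (_≡_; _≢_)
open import Relation.Nullary using (¬_)

record Graph (n : ℕ) : Set where
  field
    adj    : Fin n → Fin n → Bool
    sym    : ∀ u v → adj u v ≡ adj v u
    irrefl : ∀ v → adj v v ≡ false
open Graph public

count : {n : ℕ} → (Fin n → Bool) → ℕ
count {zero}  f = 0
count {suc n} f = (if f zero then 1 else 0) + count (λ x → f (suc x))

allB : {n : ℕ} → (Fin n → Bool) → Bool
allB {zero}  f = true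
allB {suc n} f = f zero ∧ allB (λ x → f (suc x))

deg : {n : ℕ} → Graph n → Fin n → ℕ
deg G v = count (adj G v)

-- Colour Refinement with monochromatic initial colouring.
-- sameCol G i u v = true  iff  χ^i_G(u) = χ^i_G(v).
-- Equality of the multisets {{χ^i(w) | w ∈ N(u)}} and {{χ^i(w) | w ∈ N(v)}}
-- is spelled out as: for every colour (represented by a vertex w), u and v
-- have the same number of neighbours of colour χ^i(w).
sameCol : {n : ℕ} → Graph n → ℕ → Fin n → Fin n → Bool
sameCol G zero    u v = true
sameCol G (suc i) u v =
  sameCol G i u v ∧
  allB (λ w → count (λ x → adj G u x ∧ sameCol G i x w)
           ≡ᵇ count (λ x → adj G v x ∧ sameCol G i x w))

SamePartition : {n : ℕ} → Graph n → ℕ → ℕ → Set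
SamePartition G i j = ∀ u v → sameCol G i u v ≡ sameCol G j u v

IsWL1 : {n : ℕ} → Graph n → ℕ → Set
IsWL1 G j = SamePartition G j (suc j) × (∀ k → k < j → ¬ SamePartition G k (suc k))

LongRefinement : {n : ℕ} → Graph n → Set
LongRefinement {n} G = IsWL1 G (n ∸ 1)

DegSet23 : {n : ℕ} → Graph n → Set
DegSet23 G = (∀ v → deg G v ≡ 2 ⊎ deg G v ≡ 3)
           × (∃[ v ] deg G v ≡ 2) × (∃[ v ] deg G v ≡ 3)

classSize : {n : ℕ} → Graph n → ℕ → Fin n → ℕ
classSize G j v = count (sameCol G j v)

AllPairs : {n : ℕ} → Graph n → ℕ → Set
AllPairs G i = ∀ v → classSize G i v ≡ 2

-- Pairs are the classes of π^i; a pair is represented by any of its vertices.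
-- w ∈ pair(p)
InPair : {n : ℕ} → Graph n → ℕ → Fin n → Fin n → Set
InPair G i p w = sameCol G i p w ≡ true

-- splitting order: pair(p) ≺ pair(q) iff at some iteration j the class of p
-- is already a singleton while the class of q is not (yet).
Prec : {n : ℕ} → Graph n → Fin n → Fin n → Set
Prec G p q = ∃[ j ] (classSize G j p ≡ 1 × classSize G j q ≢ 1)

IsMin : {n : ℕ} → Graph n → ℕ → Fin n → Set
IsMin G i p = ¬ (∃[ q ] Prec G q p)

-- S(pair(p)) ≺ pair(q): some pair lies strictly between them
SuccPrec : {n : ℕ} → Graph n → Fin n → Fin n → Set
SuccPrec G p q = ∃[ r ] (Prec G p r × Prec G r q)

PairEdge : {n : ℕ} → Graph n → ℕ → Fin n → Fin n → Set
PairEdge G i p q = ∃[ u ] ∃[ w ] (InPair G i p u × InPair G i q w × adj G u w ≡ true)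

CaseA : {n : ℕ} → Graph n → ℕ → Fin n → Set
CaseA G i p1 = ¬ IsMin G i p1 × (∀ p2 → SuccPrec G p1 p2 → ¬ PairEdge G i p1 p2)

CaseB : {n : ℕ} → Graph n → ℕ → Fin n → Set
CaseB G i p1 =
  IsMin G i p1 ×
  ∃[ p2 ] ∃[ p2' ]
    ( ¬ InPair G i p2 p2'
    × SuccPrec G p1 p2 × PairEdge G i p1 p2
    × SuccPrec G p1 p2' × PairEdge G i p1 p2'
    × (∀ q → SuccPrec G p1 q → PairEdge G i p1 q → InPair G i p2 q ⊎ InPair G i p2' q)
    × ∃[ v1 ] ( InPair G i p1 v1
              × (∀ w → InPair G i p2 w → adj G v1 w ≡ true)
              × (∀ u w → InPair G i p1 u → u ≢ v1 → InPair G i p2' w → adj G u w ≡ true)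
              × (∀ w → InPair G i p2' w → adj G v1 w ≡ false)
              × (∀ u w → InPair G i p1 u → u ≢ v1 → InPair G i p2 w → adj G u w ≡ false)))

-- In a long-refinement graph every round of colour refinement creates exactly one new colour class
-- (there are at most n classes and at least one more per round), so once all classes are pairs,
-- exactly one pair is split per round and a class never splits into more than two.  The pair split
-- in round t + 1 is told apart by the pair split in round t, and the balanced 2×2 adjacency matrix
-- between the two pairs shows that each vertex of the older pair sees exactly one vertex of the
-- younger one.
-- (a) If P₁ is not split first, a vertex of P₁ with an edge to a pair split after S(P₁) would see
-- that whole pair, the pair that split P₁ and a vertex of S(P₁): four neighbours, too many.
-- (b) If P₁ is split first, the class of π^(i-1) that separated its vertices consists of two pairs
-- P₂, P₂′ that outlive S(P₁).  Counting neighbours in it, one vertex of P₁ sees all of P₂ and none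
-- of P₂′, the other the reverse, and degree 3 leaves no room for edges to any other later pair.

module Submission where

import Algebra.Properties.CommutativeSemigroup
open import Data.Bool using (Bool; true; false; _∧_; not; if_then_else_)
open import Data.Bool.Properties using (∧-identityʳ; ∧-zeroʳ; T-≡; ¬-not)
import Data.Bool.Properties as Bool
open import Data.Empty using (⊥; ⊥-elim)
open import Data.Fin using (Fin; zero; suc; toℕ)
open import Data.Fin.Base using () renaming (_<_ to _<ꟳ_)
open import Data.Fin.Induction using (<-wellFounded)
open import Data.Fin.Properties using (_≟_; toℕ-injective; all?; ¬∀⟶∃¬)
open import Data.List using (List; []; _∷_; map; length)
open import Data.List.Membership.Propositional using (_∈_)
open import Data.List.Properties using (map-cong-local)
open import Data.List.Relation.Unary.All as All using (All; []; _∷_)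
open import Data.List.Relation.Unary.All.Properties using (¬Any⇒All¬)
open import Data.List.Relation.Unary.AllPairs using ([]; _∷_)
open import Data.List.Relation.Unary.Any using (here; there; any?)
open import Data.List.Relation.Unary.Unique.Propositional using (Unique)
open import Data.Nat using (ℕ; zero; suc; _+_; _∸_; _≡ᵇ_; _<ᵇ_; _≤_; _<_; _<?_; z≤n; s≤s; s≤s⁻¹)
open import Data.Nat.ListAction using (sum)
open import Data.Nat.Properties hiding (_≟_)
open import Data.Product using (_×_; _,_; proj₁; proj₂; ∃-syntax)
open import Data.Sum using (_⊎_; inj₁; inj₂; [_,_]′)
open import Defs hiding (sym)
open import Function using (_∘_)
open import Function.Bundles using (Equivalence)
open import Induction.WellFounded using (Acc; acc)
open import Relation.Binary.Definitions using (tri<; tri≈; tri>)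
open import Relation.Binary.PropositionalEquality
open import Relation.Nullary using (¬_; Dec; yes; no; does; _→-dec_)

open Equivalence using (to; from)
open Algebra.Properties.CommutativeSemigroup +-commutativeSemigroup using (x∙yz≈y∙xz; interchange)

true≢false : true ≢ false
true≢false ()

∧-elimˡ : ∀ {a b} → a ∧ b ≡ true → a ≡ true
∧-elimˡ {true} _ = refl

∧-elimʳ : ∀ {a b} → a ∧ b ≡ true → b ≡ true
∧-elimʳ {true} e = e

∧-intro : ∀ {a b} → a ≡ true → b ≡ true → a ∧ b ≡ true
∧-intro refl refl = refl

≢-true : ∀ {a b : Bool} → a ≢ b → a ≡ true ⊎ b ≡ true
≢-true {true}          _   = inj₁ refl
≢-true {false} {true}  _   = inj₂ refl
≢-true {false} {false} a≢b = ⊥-elim (a≢b refl)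

no-three-distinct-bools : ∀ {a b c : Bool} → a ≢ b → a ≢ c → b ≢ c → ⊥
no-three-distinct-bools {true}  {true}  a≢b _ _ = a≢b refl
no-three-distinct-bools {false} {false} a≢b _ _ = a≢b refl
no-three-distinct-bools {true}  {false} {true}  _ a≢c _ = a≢c refl
no-three-distinct-bools {true}  {false} {false} _ _ b≢c = b≢c refl
no-three-distinct-bools {false} {true}  {false} _ a≢c _ = a≢c refl
no-three-distinct-bools {false} {true}  {true}  _ _ b≢c = b≢c refl

-- Exactly the summand of count, so count f unfolds to bit (f zero) + count (f ∘ suc).
bit : Bool → ℕ
bit b = if b then 1 else 0

bit-injective : ∀ {a b} → bit a ≡ bit b → a ≡ b
bit-injective {true}  {true}  _ = refl
bit-injective {false} {false} _ = refl

double-injective : ∀ {m n} → m + m ≡ n + n → m ≡ n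
double-injective {m} {n} m+m≡n+n with <-cmp m n
... | tri< m<n _ _ = ⊥-elim (<-irrefl m+m≡n+n (+-mono-< m<n m<n))
... | tri≈ _ m≡n _ = m≡n
... | tri> _ _ n<m = ⊥-elim (<-irrefl (sym m+m≡n+n) (+-mono-< n<m n<m))

-- Rows a, b and columns u, v of a 0/1 matrix: equal column sums carry a non-constant row to the other row.
differ-transfer : ∀ au av bu bv → bit au + bit bu ≡ bit av + bit bv → au ≢ av → bu ≢ bv
differ-transfer au av bu bv columns au≢av refl = au≢av (bit-injective (+-cancelʳ-≡ (bit bu) _ _ columns))

bits-differ-sum : ∀ {a b} → a ≢ b → bit a + bit b ≡ 1
bits-differ-sum {true}  {false} _ = refl
bits-differ-sum {false} {true}  _ = refl
bits-differ-sum {true}  {true}  a≢b = ⊥-elim (a≢b refl)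
bits-differ-sum {false} {false} a≢b = ⊥-elim (a≢b refl)

opposite-bits : ∀ p q r s → bit p + bit q ≡ bit r + bit s → p ≢ r → q ≡ r × s ≡ p
opposite-bits true  false false true  _  _   = refl , refl
opposite-bits false true  true  false _  _   = refl , refl
opposite-bits true  _     true  _     _  p≢r = ⊥-elim (p≢r refl)
opposite-bits false _     false _     _  p≢r = ⊥-elim (p≢r refl)
opposite-bits true  false false false () _
opposite-bits true  true  false false () _
opposite-bits true  true  false true  () _
opposite-bits false false true  true  () _
opposite-bits false true  true  true  () _
opposite-bits false false true  false () _

module _ {n : ℕ} where

  remove : (Fin n → Bool) → Fin n → Fin n → Bool
  remove f x y = f y ∧ not (does (y ≟ x))

  remove-self : ∀ f x → remove f x x ≡ false
  remove-self f x with x ≟ x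
  ... | yes _ = ∧-zeroʳ (f x)
  ... | no x≢x = ⊥-elim (x≢x refl)

  remove-other : ∀ f x y → y ≢ x → remove f x y ≡ f y
  remove-other f x y y≢x with y ≟ x
  ... | yes y≡x = ⊥-elim (y≢x y≡x)
  ... | no _ = ∧-identityʳ (f y)

  remove-⊆ : ∀ f x y → remove f x y ≡ true → f y ≡ true
  remove-⊆ f x y = ∧-elimˡ

  remove-≢ : ∀ f x y → remove f x y ≡ true → y ≢ x
  remove-≢ f x y e refl = true≢false (trans (sym e) (remove-self f x))

count-cong : ∀ {n} {f g : Fin n → Bool} → (∀ x → f x ≡ g x) → count f ≡ count g
count-cong {zero} f≗g = refl
count-cong {suc n} f≗g = cong₂ _+_ (cong bit (f≗g zero)) (count-cong (λ x → f≗g (suc x)))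

count-remove : ∀ {n} (f : Fin n → Bool) x → count f ≡ bit (f x) + count (remove f x)
count-remove {suc n} f zero =
  cong₂ (λ b c → bit (f zero) + (bit b + c)) (sym (∧-zeroʳ (f zero)))
        (count-cong (λ y → sym (∧-identityʳ (f (suc y)))))
count-remove {suc n} f (suc x) = begin
  bit (f zero) + count (λ y → f (suc y))
    ≡⟨ cong (bit (f zero) +_) (count-remove (λ y → f (suc y)) x) ⟩
  bit (f zero) + (bit (f (suc x)) + count (remove (λ y → f (suc y)) x))
    ≡⟨ x∙yz≈y∙xz (bit (f zero)) (bit (f (suc x))) _ ⟩
  bit (f (suc x)) + (bit (f zero) + count (remove (λ y → f (suc y)) x))
    ≡⟨ cong (λ b → bit (f (suc x)) + (bit b + count (remove (λ y → f (suc y)) x))) (sym (∧-identityʳ (f zero))) ⟩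
  bit (f (suc x)) + count (remove f (suc x)) ∎
  where open ≡-Reasoning

count-remove-true : ∀ {n} (f : Fin n → Bool) x → f x ≡ true → count f ≡ suc (count (remove f x))
count-remove-true f x fx = trans (count-remove f x) (cong (λ b → bit b + count (remove f x)) fx)

count-false : ∀ {n} (f : Fin n → Bool) → (∀ x → f x ≡ false) → count f ≡ 0
count-false {zero} f f≡false = refl
count-false {suc n} f f≡false rewrite f≡false zero = count-false _ (λ x → f≡false (suc x))

count≡0 : ∀ {n} (f : Fin n → Bool) → count f ≡ 0 → ∀ x → f x ≡ false
count≡0 f c x with f x in fx
... | false = refl
... | true = ⊥-elim (1+n≢0 (trans (sym (count-remove-true f x fx)) c))

count-witness : ∀ {n} (f : Fin n → Bool) → 0 < count f → ∃[ x ] f x ≡ true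
count-witness {suc n} f c with f zero in f0
... | true = zero , f0
... | false = let (x , fx) = count-witness (λ y → f (suc y)) c in suc x , fx

count-mono : ∀ {n} (f g : Fin n → Bool) → (∀ x → f x ≡ true → g x ≡ true) → count f ≤ count g
count-mono {zero} f g f⊆g = z≤n
count-mono {suc n} f g f⊆g with f zero in f0 | g zero in g0
... | true  | true  = s≤s (count-mono _ _ (λ x → f⊆g (suc x)))
... | true  | false = ⊥-elim (true≢false (trans (sym (f⊆g zero f0)) g0))
... | false | true  = m≤n⇒m≤1+n (count-mono _ _ (λ x → f⊆g (suc x)))
... | false | false = count-mono _ _ (λ x → f⊆g (suc x))

count-true : ∀ {n} → count {n} (λ _ → true) ≡ n
count-true {zero} = refl
count-true {suc n} = cong suc count-true

count-≤ : ∀ {n} (f : Fin n → Bool) → count f ≤ n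
count-≤ f = subst (count f ≤_) count-true (count-mono f (λ _ → true) (λ _ _ → refl))

count-sum : ∀ {n} (f : Fin n → Bool) (xs : List (Fin n)) → Unique xs →
            (∀ x → f x ≡ true → x ∈ xs) → count f ≡ sum (map (λ x → bit (f x)) xs)
count-sum f [] _ support = count-false f λ x → lemma x
  where lemma : ∀ x → f x ≡ false
        lemma x with f x in fx
        ... | false = refl
        ... | true with support x fx
        ...   | ()
count-sum f (x ∷ xs) (x∉xs ∷ unique) support = begin
  count f                                          ≡⟨ count-remove f x ⟩
  bit (f x) + count (remove f x)                   ≡⟨ cong (bit (f x) +_) (count-sum (remove f x) xs unique support′) ⟩
  bit (f x) + sum (map (λ y → bit (remove f x y)) xs)
    ≡⟨ cong (λ ys → bit (f x) + sum ys) (map-cong-local (All.map (cong bit ∘ remove-other f x _ ∘ ≢-sym) x∉xs)) ⟩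
  bit (f x) + sum (map (λ y → bit (f y)) xs)       ∎
  where
    open ≡-Reasoning
    support′ : ∀ y → remove f x y ≡ true → y ∈ xs
    support′ y e with support y (remove-⊆ f x y e)
    ... | here y≡x = ⊥-elim (remove-≢ f x y e y≡x)
    ... | there y∈xs = y∈xs

count-≥ : ∀ {n} (f g : Fin n → Bool) (xs : List (Fin n)) → Unique xs → (∀ x → f x ≡ true → g x ≡ true) →
          All (λ x → f x ≡ false × g x ≡ true) xs → count f + length xs ≤ count g
count-≥ f g [] _ f⊆g _ = ≤-trans (≤-reflexive (+-identityʳ (count f))) (count-mono f g f⊆g)
count-≥ f g (x ∷ xs) (x∉xs ∷ unique) f⊆g ((fx , gx) ∷ rest) rewrite count-remove-true g x gx =
  ≤-trans (≤-reflexive (+-suc (count f) (length xs)))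
          (s≤s (count-≥ f (remove g x) xs unique f⊆g′ (All.zipWith still-new (x∉xs , rest))))
  where
    f⊆g′ : ∀ y → f y ≡ true → remove g x y ≡ true
    f⊆g′ y fy = trans (remove-other g x y (λ { refl → true≢false (trans (sym fy) fx) })) (f⊆g y fy)
    still-new : ∀ {y} → x ≢ y × (f y ≡ false × g y ≡ true) → f y ≡ false × remove g x y ≡ true
    still-new {y} (x≢y , fy , gy) = fy , trans (remove-other g x y (≢-sym x≢y)) gy

length≤count : ∀ {n} (f : Fin n → Bool) (xs : List (Fin n)) → Unique xs → All (λ x → f x ≡ true) xs →
               length xs ≤ count f
length≤count {n} f xs unique fxs = subst (_≤ count f) (cong (_+ length xs) (count-false {n} (λ _ → false) (λ _ → refl)))
  (count-≥ (λ _ → false) f xs unique (λ _ ()) (All.map (refl ,_) fxs))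

count-within : ∀ {n} (f : Fin n → Bool) (xs : List (Fin n)) → Unique xs → All (λ x → f x ≡ true) xs →
               count f ≤ length xs → ∀ y → f y ≡ true → y ∈ xs
count-within f xs unique fxs count≤length y fy with any? (y ≟_) xs
... | yes y∈xs = y∈xs
... | no y∉xs = ⊥-elim (1+n≰n (≤-trans
  (length≤count f (y ∷ xs) (¬Any⇒All¬ xs y∉xs ∷ unique) (fy ∷ fxs)) count≤length))

count-full : ∀ {n} (f : Fin n → Bool) → n ≤ count f → ∀ x → f x ≡ true
count-full {n} f n≤count x with f x in fx
... | true = refl
... | false = ⊥-elim (1+n≰n (subst (_≤ n) (+-comm n 1) (≤-trans (+-monoˡ-≤ 1 n≤count) one-missing)))
  where one-missing = subst (count f + 1 ≤_) (count-true {n})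
          (count-≥ {n} f (λ _ → true) (x ∷ []) (All.[] ∷ []) (λ _ _ → refl) ((fx , refl) ∷ []))

count≡2 : ∀ {n} (f : Fin n → Bool) → count f ≡ 2 → ∀ x → f x ≡ true →
          ∃[ y ] (y ≢ x × f y ≡ true × (∀ z → f z ≡ true → z ≡ x ⊎ z ≡ y))
count≡2 f count≡2 x fx = y , remove-≢ f x y ry , remove-⊆ f x y ry , within
  where
    one-more : count (remove f x) ≡ 1
    one-more = suc-injective (trans (sym (count-remove-true f x fx)) count≡2)
    y = proj₁ (count-witness (remove f x) (≤-reflexive (sym one-more)))
    ry = proj₂ (count-witness (remove f x) (≤-reflexive (sym one-more)))
    none-more : count (remove (remove f x) y) ≡ 0
    none-more = suc-injective (trans (sym (count-remove-true (remove f x) y ry)) one-more)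
    within : ∀ z → f z ≡ true → z ≡ x ⊎ z ≡ y
    within z fz with z ≟ x | z ≟ y
    ... | yes z≡x | _ = inj₁ z≡x
    ... | no _ | yes z≡y = inj₂ z≡y
    ... | no z≢x | no z≢y = ⊥-elim (true≢false (trans (sym in-rest) (count≡0 (remove (remove f x) y) none-more z)))
      where in-rest : remove (remove f x) y z ≡ true
            in-rest = trans (remove-other (remove f x) y z z≢y) (trans (remove-other f x z z≢x) fz)

allB-sound : ∀ {n} (f : Fin n → Bool) → allB f ≡ true → ∀ x → f x ≡ true
allB-sound {suc n} f e zero = ∧-elimˡ e
allB-sound {suc n} f e (suc x) = allB-sound (λ y → f (suc y)) (∧-elimʳ {f zero} e) x

allB-complete : ∀ {n} (f : Fin n → Bool) → (∀ x → f x ≡ true) → allB f ≡ true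
allB-complete {zero} f _ = refl
allB-complete {suc n} f all = ∧-intro (all zero) (allB-complete _ (λ x → all (suc x)))

allB-counterexample : ∀ {n} (f : Fin n → Bool) → allB f ≡ false → ∃[ x ] f x ≡ false
allB-counterexample {suc n} f e with f zero in f0
... | false = zero , f0
... | true = let (x , fx) = allB-counterexample (λ y → f (suc y)) e in suc x , fx

module ColourRefinement {n : ℕ} (G : Graph n) where

  record _∼[_]_ (u : Fin n) (j : ℕ) (v : Fin n) : Set where
    constructor mk∼
    field holds : sameCol G j u v ≡ true
  open _∼[_]_ public

  colourDeg : ℕ → Fin n → Fin n → ℕ
  colourDeg j u w = count (λ x → adj G u x ∧ sameCol G j x w)

  ∼-suc⇒ : ∀ {j u v} → u ∼[ suc j ] v → u ∼[ j ] v × (∀ w → colourDeg j u w ≡ colourDeg j v w)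
  ∼-suc⇒ {j} {u} {v} (mk∼ e) =
    mk∼ (∧-elimˡ e) , λ w → ≡ᵇ⇒≡ _ _ (T-≡ .from (allB-sound _ (∧-elimʳ {sameCol G j u v} e) w))

  ∼-suc⇐ : ∀ {j u v} → u ∼[ j ] v → (∀ w → colourDeg j u w ≡ colourDeg j v w) → u ∼[ suc j ] v
  ∼-suc⇐ (mk∼ e) same = mk∼ (∧-intro e (allB-complete _ (λ w → T-≡ .to (≡⇒≡ᵇ _ _ (same w)))))

  ≁⇒false : ∀ {j u v} → ¬ u ∼[ j ] v → sameCol G j u v ≡ false
  ≁⇒false {j} {u} {v} u≁v with sameCol G j u v in e
  ... | true = ⊥-elim (u≁v (mk∼ e))
  ... | false = refl

  ∼? : ∀ j u v → Dec (u ∼[ j ] v)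
  ∼? j u v with sameCol G j u v in e
  ... | true = yes (mk∼ e)
  ... | false = no (λ u∼v → true≢false (trans (sym (holds u∼v)) e))

  refines-at : ∀ {j u v} → u ∼[ j ] v → ¬ u ∼[ suc j ] v → ∃[ w ] colourDeg j u w ≢ colourDeg j v w
  refines-at {j} {u} {v} (mk∼ u∼v) u≁v with allB (λ w → colourDeg j u w ≡ᵇ colourDeg j v w) in all
  ... | true = ⊥-elim (u≁v (mk∼ (∧-intro u∼v all)))
  ... | false = let (w , differ) = allB-counterexample _ all
                in w , λ same → true≢false (trans (sym (T-≡ .to (≡⇒≡ᵇ _ _ same))) differ)

  ∼-refl : ∀ {j} u → u ∼[ j ] u
  ∼-refl {zero} u = mk∼ refl
  ∼-refl {suc j} u = ∼-suc⇐ (∼-refl u) (λ _ → refl)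

  sameCol-refl : ∀ j u → sameCol G j u u ≡ true
  sameCol-refl j u = holds (∼-refl {j} u)

  ∼-sym : ∀ {j u v} → u ∼[ j ] v → v ∼[ j ] u
  ∼-sym {zero} _ = mk∼ refl
  ∼-sym {suc j} e = let (u∼v , same) = ∼-suc⇒ e in ∼-suc⇐ (∼-sym u∼v) (λ w → sym (same w))

  ∼-trans : ∀ {j u v z} → u ∼[ j ] v → v ∼[ j ] z → u ∼[ j ] z
  ∼-trans {zero} _ _ = mk∼ refl
  ∼-trans {suc j} e₁ e₂ =
    let (u∼v , same₁) = ∼-suc⇒ e₁
        (v∼z , same₂) = ∼-suc⇒ e₂
    in ∼-suc⇐ (∼-trans u∼v v∼z) (λ w → trans (same₁ w) (same₂ w))

  ∼-pred : ∀ {j u v} → u ∼[ suc j ] v → u ∼[ j ] v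
  ∼-pred e = proj₁ (∼-suc⇒ e)

  ∼-mono : ∀ {j k u v} → j ≤ k → u ∼[ k ] v → u ∼[ j ] v
  ∼-mono {k = zero} z≤n e = e
  ∼-mono {k = suc k} j≤1+k e with m≤n⇒m<n∨m≡n j≤1+k
  ... | inj₁ j<1+k = ∼-mono (s≤s⁻¹ j<1+k) (∼-pred e)
  ... | inj₂ refl = e

  sameCol-cong : ∀ {j k x w w′} → (x ∼[ j ] w → x ∼[ k ] w′) → (x ∼[ k ] w′ → x ∼[ j ] w) →
                 sameCol G j x w ≡ sameCol G k x w′
  sameCol-cong {j} {k} {x} {w} {w′} forth back with ∼? j x w | ∼? k x w′
  ... | yes x∼w | yes x∼w′ = trans (holds x∼w) (sym (holds x∼w′))
  ... | yes x∼w | no x≁w′  = ⊥-elim (x≁w′ (forth x∼w))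
  ... | no x≁w  | yes x∼w′ = ⊥-elim (x≁w (back x∼w′))
  ... | no x≁w  | no x≁w′  = trans (≁⇒false x≁w) (sym (≁⇒false x≁w′))

  colourDeg-cong : ∀ {j k w w′} u → (∀ {x} → x ∼[ j ] w → x ∼[ k ] w′) →
                   (∀ {x} → x ∼[ k ] w′ → x ∼[ j ] w) →
                   colourDeg j u w ≡ colourDeg k u w′
  colourDeg-cong u forth back = count-cong (λ x → cong (adj G u x ∧_) (sameCol-cong forth back))

  colourDeg-congʳ : ∀ {j w w′} u → w ∼[ j ] w′ → colourDeg j u w ≡ colourDeg j u w′
  colourDeg-congʳ u w∼w′ =
    colourDeg-cong u (λ x∼w → ∼-trans x∼w w∼w′) (λ x∼w′ → ∼-trans x∼w′ (∼-sym w∼w′))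

  -- Colour classes are counted through their least-indexed vertices.
  Rep : ℕ → Fin n → Set
  Rep j v = ∀ u → toℕ u < toℕ v → ¬ u ∼[ j ] v

  isRep : ℕ → Fin n → Bool
  isRep j v = allB (λ u → not ((toℕ u <ᵇ toℕ v) ∧ sameCol G j u v))

  classCount : ℕ → ℕ
  classCount j = count (isRep j)

  isRep-complete : ∀ {j v} → Rep j v → isRep j v ≡ true
  isRep-complete {j} {v} rep = allB-complete _ check
    where
      check : ∀ u → not ((toℕ u <ᵇ toℕ v) ∧ sameCol G j u v) ≡ true
      check u with toℕ u <ᵇ toℕ v in lt | sameCol G j u v in same
      ... | true  | true  = ⊥-elim (rep u (<ᵇ⇒< _ _ (T-≡ .from lt)) (mk∼ same))
      ... | true  | false = refl
      ... | false | _     = refl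

  isRep-sound : ∀ {j v} → isRep j v ≡ true → Rep j v
  isRep-sound {j} {v} rep u u<v (mk∼ u∼v) =
    true≢false (sym (subst₂ (λ a b → not (a ∧ b) ≡ true) (T-≡ .to (<⇒<ᵇ u<v)) u∼v (allB-sound _ rep u)))

  Rep-or-smaller : ∀ j v → Rep j v ⊎ ∃[ u ] (toℕ u < toℕ v × u ∼[ j ] v)
  Rep-or-smaller j v with isRep j v in rep
  ... | true = inj₁ (isRep-sound rep)
  ... | false with allB-counterexample _ rep
  ...   | u , e with toℕ u <ᵇ toℕ v in lt | sameCol G j u v in same
  ...     | true | true = inj₂ (u , <ᵇ⇒< _ _ (T-≡ .from lt) , mk∼ same)

  rep-exists : ∀ j u → ∃[ m ] (u ∼[ j ] m × Rep j m)
  rep-exists j u = go u (<-wellFounded u)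
    where
      go : ∀ u → Acc _<ꟳ_ u → ∃[ m ] (u ∼[ j ] m × Rep j m)
      go u (acc smaller) with Rep-or-smaller j u
      ... | inj₁ rep = u , ∼-refl u , rep
      ... | inj₂ (w , w<u , w∼u) =
        let (m , w∼m , rep) = go w (smaller w<u) in m , ∼-trans (∼-sym w∼u) w∼m , rep

  rep : ℕ → Fin n → Fin n
  rep j u = proj₁ (rep-exists j u)

  ∼-rep : ∀ j u → u ∼[ j ] rep j u
  ∼-rep j u = proj₁ (proj₂ (rep-exists j u))

  Rep-rep : ∀ j u → Rep j (rep j u)
  Rep-rep j u = proj₂ (proj₂ (rep-exists j u))

  rep-unique : ∀ {j m m′} → Rep j m → Rep j m′ → m ∼[ j ] m′ → m ≡ m′
  rep-unique {m = m} {m′} rep rep′ m∼m′ with <-cmp (toℕ m) (toℕ m′)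
  ... | tri< m<m′ _ _ = ⊥-elim (rep′ m m<m′ m∼m′)
  ... | tri≈ _ m≡m′ _ = toℕ-injective m≡m′
  ... | tri> _ _ m′<m = ⊥-elim (rep m′ m′<m (∼-sym m∼m′))

  Rep-suc : ∀ {j v} → Rep j v → Rep (suc j) v
  Rep-suc rep u u<v u∼v = rep u u<v (∼-pred u∼v)

  new-rep : ∀ {j u v} → u ∼[ j ] v → ¬ u ∼[ suc j ] v → ∃[ m ] (Rep (suc j) m × ¬ Rep j m × u ∼[ j ] m)
  new-rep {j} {u} {v} u∼v u≁v
    with rep-exists (suc j) u | rep-exists (suc j) v
  ... | mu , u∼mu , rep-mu | mv , v∼mv , rep-mv
    with Rep-or-smaller j mu | Rep-or-smaller j mv
  ... | inj₂ (w , w<mu , w∼mu) | _ = mu , rep-mu , (λ rep → rep w w<mu w∼mu) , ∼-pred u∼mu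
  ... | inj₁ _ | inj₂ (w , w<mv , w∼mv) =
    mv , rep-mv , (λ rep → rep w w<mv w∼mv) , ∼-trans u∼v (∼-pred v∼mv)
  ... | inj₁ old-mu | inj₁ old-mv = ⊥-elim (u≁v (∼-trans u∼mu (subst (_∼[ suc j ] v) (sym mu≡mv) (∼-sym v∼mv))))
    where mu≡mv = rep-unique old-mu old-mv (∼-trans (∼-sym (∼-pred u∼mu)) (∼-trans u∼v (∼-pred v∼mv)))

  isRep-false : ∀ {j v} → isRep j v ≡ false → ¬ Rep j v
  isRep-false ¬rep rep = true≢false (trans (sym (isRep-complete rep)) ¬rep)

  classCount-grows : ∀ j (ms : List (Fin n)) → Unique ms → All (λ m → Rep (suc j) m × ¬ Rep j m) ms →
                     classCount j + length ms ≤ classCount (suc j)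
  classCount-grows j ms unique new = count-≥ (isRep j) (isRep (suc j)) ms unique
    (λ v rep → isRep-complete (Rep-suc (isRep-sound {j} {v} rep)))
    (All.map (λ (rep , ¬old) → ≁rep⇒false ¬old , isRep-complete rep) new)
    where
      ≁rep⇒false : ∀ {v} → ¬ Rep j v → isRep j v ≡ false
      ≁rep⇒false {v} ¬rep with isRep j v in rep
      ... | true = ⊥-elim (¬rep (isRep-sound rep))
      ... | false = refl

module LongRefinementGraph {N : ℕ} (G : Graph (suc N)) (long : LongRefinement G) where
  open ColourRefinement G

  refines-strictly : ∀ k → k < N → ∃[ u ] ∃[ v ] (u ∼[ k ] v × ¬ u ∼[ suc k ] v)
  refines-strictly k k<N =
    let (u , ¬row) = ¬∀⟶∃¬ _ _ (λ u → all? (λ v → sameCol G k u v Bool.≟ sameCol G (suc k) u v)) (proj₂ long k k<N)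
        (v , differ) = ¬∀⟶∃¬ _ _ (λ v → sameCol G k u v Bool.≟ sameCol G (suc k) u v) ¬row
    in u , v , settle differ
    where
      settle : ∀ {u v} → sameCol G k u v ≢ sameCol G (suc k) u v → u ∼[ k ] v × ¬ u ∼[ suc k ] v
      settle {u} {v} differ with ∼? (suc k) u v
      ... | yes u∼v = ⊥-elim (differ (trans (holds (∼-pred u∼v)) (sym (holds u∼v))))
      ... | no u≁v with ∼? k u v
      ...   | yes u∼v = u∼v , u≁v
      ...   | no u≁′v = ⊥-elim (differ (trans (≁⇒false u≁′v) (sym (≁⇒false u≁v))))

  classCount-step : ∀ k → k < N → classCount k < classCount (suc k)
  classCount-step k k<N =
    let (u , v , u∼v , u≁v) = refines-strictly k k<N
        (m , new , ¬old , _) = new-rep u∼v u≁v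
    in ≤-trans (≤-reflexive (sym (+-comm (classCount k) 1)))
               (classCount-grows k (m ∷ []) (All.[] ∷ []) ((new , ¬old) ∷ []))

  classCount-lower : ∀ k → k ≤ N → k < classCount k
  classCount-lower zero _ =
    let (m , _ , rep) = rep-exists 0 zero in length≤count (isRep 0) (m ∷ []) (All.[] ∷ []) (isRep-complete {0} {m} rep ∷ [])
  classCount-lower (suc k) 1+k≤N = <-≤-trans (s≤s (classCount-lower k (<⇒≤ 1+k≤N))) (classCount-step k 1+k≤N)

  classCount-+ : ∀ j d → j + d ≤ N → classCount j + d ≤ classCount (j + d)
  classCount-+ j zero _ rewrite +-identityʳ j | +-identityʳ (classCount j) = ≤-refl
  classCount-+ j (suc d) j+1+d≤N rewrite +-suc j d | +-suc (classCount j) d =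
    ≤-trans (s≤s (classCount-+ j d (<⇒≤ j+1+d≤N))) (classCount-step (j + d) j+1+d≤N)

  one-new-class : ∀ {j m m′} → j < N → Rep (suc j) m → ¬ Rep j m → Rep (suc j) m′ → ¬ Rep j m′ → m ≡ m′
  one-new-class {j} {m} {m′} j<N new ¬old new′ ¬old′ with m ≟ m′
  ... | yes m≡m′ = m≡m′
  ... | no m≢m′ = ⊥-elim (<-irrefl refl (begin-strict
      suc N                              ≡⟨ cong suc (sym (m+[n∸m]≡n j<N)) ⟩
      suc (suc j + (N ∸ suc j))          ≡⟨ cong suc (+-comm (suc j) (N ∸ suc j)) ⟩
      suc ((N ∸ suc j) + suc j)          ≤⟨ s≤s (+-monoʳ-≤ (N ∸ suc j) (classCount-lower j (<⇒≤ j<N))) ⟩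
      suc ((N ∸ suc j) + classCount j)   ≡⟨ cong suc (+-comm (N ∸ suc j) (classCount j)) ⟩
      suc (classCount j + (N ∸ suc j))   <⟨ +-monoˡ-< (N ∸ suc j) two-new ⟩
      classCount (suc j) + (N ∸ suc j)   ≤⟨ classCount-+ (suc j) (N ∸ suc j) (≤-reflexive (m+[n∸m]≡n j<N)) ⟩
      classCount (suc j + (N ∸ suc j))   ≡⟨ cong classCount (m+[n∸m]≡n j<N) ⟩
      classCount N                       ≤⟨ count-≤ (isRep N) ⟩
      suc N                              ∎))
    where
      two-new : suc (classCount j) < classCount (suc j)
      two-new = ≤-trans (≤-reflexive (+-comm 2 (classCount j)))
                  (classCount-grows j (m ∷ m′ ∷ []) ((m≢m′ ∷ []) ∷ [] ∷ [])
                                      ((new , ¬old) ∷ (new′ , ¬old′) ∷ []))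
      open ≤-Reasoning

  discrete : ∀ {k u v} → N ≤ k → u ∼[ k ] v → u ≡ v
  discrete {k} {u} {v} N≤k u∼v = rep-unique (all-reps u) (all-reps v) (∼-mono N≤k u∼v)
    where
      all-reps : ∀ w → Rep N w
      all-reps w = isRep-sound {N} {w} (count-full (isRep N) (classCount-lower N ≤-refl) w)

  one-class-splits : ∀ {j x y u v} → j < N → x ∼[ j ] y → ¬ x ∼[ suc j ] y → u ∼[ j ] v → ¬ u ∼[ suc j ] v →
                     x ∼[ j ] u
  one-class-splits j<N x∼y x≁y u∼v u≁v =
    let (m , new , ¬old , x∼m) = new-rep x∼y x≁y
        (m′ , new′ , ¬old′ , u∼m′) = new-rep u∼v u≁v
    in ∼-trans x∼m (subst (_∼[ _ ] _) (sym (one-new-class j<N new ¬old new′ ¬old′)) (∼-sym u∼m′))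

  rep-ages-differ : ∀ {j x y} → j < N → x ∼[ j ] y → ¬ x ∼[ suc j ] y →
                    isRep j (rep (suc j) x) ≢ isRep j (rep (suc j) y)
  rep-ages-differ {j} {x} {y} j<N x∼y x≁y same-age =
    x≁y (∼-trans (∼-rep (suc j) x) (subst (_∼[ suc j ] y) (sym same-rep) (∼-sym (∼-rep (suc j) y))))
    where
      same-rep : rep (suc j) x ≡ rep (suc j) y
      same-rep with isRep j (rep (suc j) x) in age
      ... | true  = rep-unique (isRep-sound {j} {rep (suc j) x} age) (isRep-sound {j} {rep (suc j) y} (sym same-age))
                      (∼-trans (∼-sym (∼-pred (∼-rep (suc j) x))) (∼-trans x∼y (∼-pred (∼-rep (suc j) y))))
      ... | false = one-new-class j<N (Rep-rep (suc j) x) (isRep-false {j} {rep (suc j) x} age)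
                      (Rep-rep (suc j) y) (isRep-false {j} {rep (suc j) y} (sym same-age))

  class-splits-in-two : ∀ {j x y z} → j < N → x ∼[ j ] y → x ∼[ j ] z → ¬ x ∼[ suc j ] y → ¬ x ∼[ suc j ] z →
                        y ∼[ suc j ] z
  class-splits-in-two {j} {x} {y} {z} j<N x∼y x∼z x≁y x≁z with ∼? (suc j) y z
  ... | yes y∼z = y∼z
  ... | no y≁z = ⊥-elim (no-three-distinct-bools
          (rep-ages-differ j<N x∼y x≁y) (rep-ages-differ j<N x∼z x≁z)
          (rep-ages-differ j<N (∼-trans (∼-sym x∼y) x∼z) y≁z))

module SplittingPairs {N : ℕ} (G : Graph (suc N)) (long : LongRefinement G) (i : ℕ) (pairs : AllPairs G i) where
  open ColourRefinement G
  open LongRefinementGraph G long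

  -- Abstract, so that unification never unfolds the counting argument behind the witness.
  abstract
    partner-spec : ∀ v → ∃[ y ] (y ≢ v × v ∼[ i ] y × (∀ z → v ∼[ i ] z → z ≡ v ⊎ z ≡ y))
    partner-spec v =
      let (y , y≢v , v∼y , within) = count≡2 (sameCol G i v) (pairs v) v (sameCol-refl i v)
      in y , y≢v , mk∼ v∼y , λ z v∼z → within z (holds v∼z)

  partner : Fin (suc N) → Fin (suc N)
  partner v = proj₁ (partner-spec v)

  partner-≢ : ∀ v → partner v ≢ v
  partner-≢ v = proj₁ (proj₂ (partner-spec v))

  ∼-partner : ∀ v → v ∼[ i ] partner v
  ∼-partner v = proj₁ (proj₂ (proj₂ (partner-spec v)))

  pair-members : ∀ {v z} → v ∼[ i ] z → z ≡ v ⊎ z ≡ partner v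
  pair-members {v} = proj₂ (proj₂ (proj₂ (partner-spec v))) _

  partner-involutive : ∀ v → partner (partner v) ≡ v
  partner-involutive v with pair-members (∼-sym (∼-partner v))
  ... | inj₁ v≡p = ⊥-elim (partner-≢ v (sym v≡p))
  ... | inj₂ v≡pp = sym v≡pp

  Unsplit : ℕ → Fin (suc N) → Set
  Unsplit j v = v ∼[ j ] partner v

  SplitAt : ℕ → Fin (suc N) → Set
  SplitAt j v = Unsplit j v × ¬ Unsplit (suc j) v

  Unsplit-early : ∀ {j} v → j ≤ i → Unsplit j v
  Unsplit-early v j≤i = ∼-mono j≤i (∼-partner v)

  Unsplit-pairmate : ∀ {j v y} → v ∼[ i ] y → Unsplit j v → Unsplit j y
  Unsplit-pairmate {j} {v} v∼y unsplit with pair-members v∼y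
  ... | inj₁ refl = unsplit
  ... | inj₂ refl = subst (partner v ∼[ j ]_) (sym (partner-involutive v)) (∼-sym unsplit)

  Split-pairmate : ∀ {j v y} → v ∼[ i ] y → ¬ Unsplit j v → ¬ Unsplit j y
  Split-pairmate v∼y split unsplit = split (Unsplit-pairmate (∼-sym v∼y) unsplit)

  SplitAt-pairmate : ∀ {j v y} → v ∼[ i ] y → SplitAt j v → SplitAt j y
  SplitAt-pairmate v∼y (unsplit , split) = Unsplit-pairmate v∼y unsplit , Split-pairmate v∼y split

  Unsplit≢Split : ∀ {j x y} → Unsplit j x → ¬ Unsplit j y → x ≢ y
  Unsplit≢Split unsplit split refl = split unsplit

  split⇒i< : ∀ {j v} → ¬ Unsplit j v → i < j
  split⇒i< {j} {v} split with i <? j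
  ... | yes i<j = i<j
  ... | no i≮j = ⊥-elim (split (Unsplit-early v (≮⇒≥ i≮j)))

  SplitAt⇒i≤ : ∀ {t v} → SplitAt t v → i ≤ t
  SplitAt⇒i≤ (_ , split) = s≤s⁻¹ (split⇒i< split)

  Unsplit⇒<N : ∀ {j v} → Unsplit j v → j < N
  Unsplit⇒<N {j} {v} unsplit with j <? N
  ... | yes j<N = j<N
  ... | no j≮N = ⊥-elim (partner-≢ v (sym (discrete (≮⇒≥ j≮N) unsplit)))

  Unsplit-before-split : ∀ {j k v} → Unsplit j v → ¬ Unsplit k v → j < k
  Unsplit-before-split {j} {k} unsplit split with j <? k
  ... | yes j<k = j<k
  ... | no j≮k = ⊥-elim (split (∼-mono (≮⇒≥ j≮k) unsplit))

  split-time : ∀ v → ∃[ t ] SplitAt t v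
  split-time v = search N (λ unsplit → <-irrefl refl (Unsplit⇒<N unsplit))
    where
      search : ∀ m → ¬ Unsplit m v → ∃[ t ] SplitAt t v
      search zero split = ⊥-elim (split (mk∼ refl))
      search (suc m) split with ∼? m v (partner v)
      ... | yes unsplit = m , unsplit , split
      ... | no split′ = search m split′

  late-split-time : ∀ {j v} → Unsplit (suc j) v → ∃[ t₀ ] (j ≤ t₀ × SplitAt (suc t₀) v)
  late-split-time {j} {v} unsplit with split-time v
  ... | zero , (_ , split) = ⊥-elim (1+n≰n (≤-trans (Unsplit-before-split unsplit split) (s≤s z≤n)))
  ... | suc t₀ , splits = t₀ , s≤s⁻¹ (s≤s⁻¹ (Unsplit-before-split unsplit (proj₂ splits))) , splits

  class-after-i : ∀ {j v y} → i ≤ j → v ∼[ j ] y → y ≡ v ⊎ (y ≡ partner v × Unsplit j v)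
  class-after-i i≤j v∼y with pair-members (∼-mono i≤j v∼y)
  ... | inj₁ y≡v = inj₁ y≡v
  ... | inj₂ refl = inj₂ (refl , v∼y)

  classSize≡1⇒split : ∀ {j v} → classSize G j v ≡ 1 → ¬ Unsplit j v
  classSize≡1⇒split {j} {v} size≡1 unsplit = <-irrefl (sym size≡1)
    (length≤count (sameCol G j v) (v ∷ partner v ∷ []) ((≢-sym (partner-≢ v) ∷ []) ∷ [] ∷ [])
                  (sameCol-refl j v ∷ holds unsplit ∷ []))

  split⇒classSize≡1 : ∀ {j v} → ¬ Unsplit j v → classSize G j v ≡ 1
  split⇒classSize≡1 {j} {v} split =
    trans (count-sum (sameCol G j v) (v ∷ []) (All.[] ∷ []) singleton)
          (cong (λ b → bit b + 0) (sameCol-refl j v))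
    where
      singleton : ∀ y → sameCol G j v y ≡ true → y ∈ v ∷ []
      singleton y v∼y with class-after-i (<⇒≤ (split⇒i< split)) (mk∼ v∼y)
      ... | inj₁ y≡v = here y≡v
      ... | inj₂ (_ , unsplit) = ⊥-elim (split unsplit)

  colourDeg-split : ∀ {j u w} → ¬ Unsplit j w → colourDeg j u w ≡ bit (adj G u w)
  colourDeg-split {j} {u} {w} split =
    trans (count-sum _ (w ∷ []) (All.[] ∷ []) singleton)
          (trans (+-identityʳ _) (cong bit (trans (cong (adj G u w ∧_) (sameCol-refl j w)) (∧-identityʳ _))))
    where
      singleton : ∀ y → adj G u y ∧ sameCol G j y w ≡ true → y ∈ w ∷ []
      singleton y e with class-after-i (<⇒≤ (split⇒i< split)) (∼-sym (mk∼ (∧-elimʳ {adj G u y} e)))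
      ... | inj₁ y≡w = here y≡w
      ... | inj₂ (_ , unsplit) = ⊥-elim (split unsplit)

  colourDeg-unsplit : ∀ {j u w} → i ≤ j → Unsplit j w →
                      colourDeg j u w ≡ bit (adj G u w) + bit (adj G u (partner w))
  colourDeg-unsplit {j} {u} {w} i≤j unsplit =
    trans (count-sum _ (w ∷ partner w ∷ []) ((≢-sym (partner-≢ w) ∷ []) ∷ [] ∷ []) within)
          (cong₂ _+_ (cong bit (adj-in-class w (∼-refl w)))
                     (trans (+-identityʳ _) (cong bit (adj-in-class (partner w) (∼-sym unsplit)))))
    where
      adj-in-class : ∀ y → y ∼[ j ] w → adj G u y ∧ sameCol G j y w ≡ adj G u y
      adj-in-class y y∼w = trans (cong (adj G u y ∧_) (holds y∼w)) (∧-identityʳ _)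
      within : ∀ y → adj G u y ∧ sameCol G j y w ≡ true → y ∈ w ∷ partner w ∷ []
      within y e with class-after-i i≤j (∼-sym (mk∼ (∧-elimʳ {adj G u y} e)))
      ... | inj₁ y≡w = here y≡w
      ... | inj₂ (y≡w′ , _) = there (here y≡w′)

  prec⇒ : ∀ {p q} → Prec G p q → ∃[ j ] (¬ Unsplit j p × Unsplit j q)
  prec⇒ {p} {q} (j , p-single , q-not-single) with ∼? j q (partner q)
  ... | yes unsplit = j , classSize≡1⇒split p-single , unsplit
  ... | no split = ⊥-elim (q-not-single (split⇒classSize≡1 split))

  ⇒prec : ∀ {j p q} → ¬ Unsplit j p → Unsplit j q → Prec G p q
  ⇒prec {j} split unsplit = j , split⇒classSize≡1 split , λ size≡1 → classSize≡1⇒split size≡1 unsplit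

  SuccPrec⇒Unsplit : ∀ {t p q} → SplitAt t p → SuccPrec G p q → Unsplit (suc (suc t)) q
  SuccPrec⇒Unsplit (p-unsplit , p-split) (r , p≺r , r≺q) =
    let (j₁ , p-split′ , r-unsplit) = prec⇒ p≺r
        (j₂ , r-split , q-unsplit) = prec⇒ r≺q
        t<j₁ = Unsplit-before-split p-unsplit p-split′
        1+t<j₂ = Unsplit-before-split (∼-mono t<j₁ r-unsplit) r-split
    in ∼-mono 1+t<j₂ q-unsplit

  one-pair-splits : ∀ {j x a} → SplitAt j x → SplitAt j a → x ∼[ i ] a
  one-pair-splits x-splits@(x-unsplit , x-split) (a-unsplit , a-split) =
    ∼-mono (SplitAt⇒i≤ x-splits) (one-class-splits (Unsplit⇒<N x-unsplit) x-unsplit x-split a-unsplit a-split)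

  separated-partners : ∀ {k u v} → i ≤ k → u ∼[ k ] v → ¬ u ∼[ suc k ] v → v ≡ partner u
  separated-partners {k} {u} i≤k u∼v u≁v with class-after-i i≤k u∼v
  ... | inj₁ refl = ⊥-elim (u≁v (∼-refl u))
  ... | inj₂ (v≡u′ , _) = v≡u′

  some-pair-splits : ∀ {k} → i ≤ k → k < N → ∃[ u ] SplitAt k u
  some-pair-splits {k} i≤k k<N =
    let (u , v , u∼v , u≁v) = refines-strictly k k<N
    in u , subst (u ∼[ k ]_) (separated-partners i≤k u∼v u≁v) u∼v
         , subst (λ y → ¬ u ∼[ suc k ] y) (separated-partners i≤k u∼v u≁v) u≁v

  -- Only the class split in the previous round can tell u from its partner now.
  split-cause : ∀ {j u} → i ≤ j → SplitAt (suc j) u → ∃[ c ] (SplitAt j c × adj G u c ≢ adj G (partner u) c)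
  split-cause {j} {u} i≤j (u-unsplit , u-split) with refines-at u-unsplit u-split
  ... | w , differ with ∼? (suc j) w (partner w) | ∼? j w (partner w)
  ...   | yes w-unsplit | _ = ⊥-elim (differ (begin
          colourDeg (suc j) u w                        ≡⟨ colourDeg-unsplit (m≤n⇒m≤1+n i≤j) w-unsplit ⟩
          bit (adj G u w) + bit (adj G u (partner w))  ≡⟨ colourDeg-unsplit i≤j (∼-pred w-unsplit) ⟨
          colourDeg j u w                              ≡⟨ proj₂ (∼-suc⇒ u-unsplit) w ⟩
          colourDeg j (partner u) w                    ≡⟨ colourDeg-unsplit i≤j (∼-pred w-unsplit) ⟩
          bit (adj G (partner u) w) + bit (adj G (partner u) (partner w))
                                                       ≡⟨ colourDeg-unsplit (m≤n⇒m≤1+n i≤j) w-unsplit ⟨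
          colourDeg (suc j) (partner u) w              ∎))
    where open ≡-Reasoning
  ...   | no _ | no w-split = ⊥-elim (differ (begin
          colourDeg (suc j) u w            ≡⟨ colourDeg-split (w-split ∘ ∼-pred) ⟩
          bit (adj G u w)                  ≡⟨ colourDeg-split w-split ⟨
          colourDeg j u w                  ≡⟨ proj₂ (∼-suc⇒ u-unsplit) w ⟩
          colourDeg j (partner u) w        ≡⟨ colourDeg-split w-split ⟩
          bit (adj G (partner u) w)        ≡⟨ colourDeg-split (w-split ∘ ∼-pred) ⟨
          colourDeg (suc j) (partner u) w  ∎))
    where open ≡-Reasoning
  ...   | no w-split | yes w-unsplit =
          w , (w-unsplit , w-split) ,
          λ same → differ (trans (colourDeg-split w-split) (trans (cong bit same) (sym (colourDeg-split w-split))))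

  pair-balance : ∀ {j a q} → i ≤ j → Unsplit (suc j) a → Unsplit j q →
                 bit (adj G a q) + bit (adj G a (partner q)) ≡ bit (adj G (partner a) q) + bit (adj G (partner a) (partner q))
  pair-balance i≤j a-unsplit q-unsplit =
    trans (sym (colourDeg-unsplit i≤j q-unsplit))
          (trans (proj₂ (∼-suc⇒ a-unsplit) _) (colourDeg-unsplit i≤j q-unsplit))

  split-vertex-sees-pair-alike : ∀ {j c x} → i ≤ j → ¬ Unsplit j c → Unsplit (suc j) x →
                                 adj G c x ≡ adj G c (partner x)
  split-vertex-sees-pair-alike {j} {c} {x} i≤j c-split x-unsplit =
    trans (Graph.sym G c x) (trans (bit-injective (begin
      bit (adj G x c)                ≡⟨ colourDeg-split c-split ⟨
      colourDeg j x c                ≡⟨ proj₂ (∼-suc⇒ x-unsplit) c ⟩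
      colourDeg j (partner x) c      ≡⟨ colourDeg-split c-split ⟩
      bit (adj G (partner x) c)      ∎)) (Graph.sym G (partner x) c))
    where open ≡-Reasoning

  -- Via the column balance of the 2×2 adjacency matrix between the two pairs.
  split-pair-sees-cause-oppositely : ∀ {t a u} → SplitAt t a → SplitAt (suc t) u →
    adj G a u ≢ adj G a (partner u) × adj G (partner a) u ≢ adj G (partner a) (partner u)
  split-pair-sees-cause-oppositely {t} {a} {u} a-splits u-splits with split-cause (SplitAt⇒i≤ a-splits) u-splits
  ... | c , c-splits , c-differs = transpose (proj₁ differs) , transpose (proj₂ differs)
    where
      a′ = partner a
      u′ = partner u
      balance : bit (adj G u a) + bit (adj G u a′) ≡ bit (adj G u′ a) + bit (adj G u′ a′)
      balance = pair-balance (SplitAt⇒i≤ a-splits) (proj₁ u-splits) (proj₁ a-splits)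
      balance′ : bit (adj G u a′) + bit (adj G u a) ≡ bit (adj G u′ a′) + bit (adj G u′ a)
      balance′ = trans (+-comm (bit (adj G u a′)) _) (trans balance (+-comm (bit (adj G u′ a)) _))
      differs : adj G u a ≢ adj G u′ a × adj G u a′ ≢ adj G u′ a′
      differs with pair-members (one-pair-splits a-splits c-splits)
      ... | inj₁ refl = c-differs , differ-transfer _ _ _ _ balance c-differs
      ... | inj₂ refl = differ-transfer _ _ _ _ balance′ c-differs , c-differs
      transpose : ∀ {x} → adj G u x ≢ adj G u′ x → adj G x u ≢ adj G x u′
      transpose {x} differ same = differ (trans (Graph.sym G u x) (trans same (Graph.sym G x u′)))

  pair-views-itself-alike : ∀ {j a} → i ≤ j → Unsplit j a → colourDeg j a a ≡ colourDeg j (partner a) a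
  pair-views-itself-alike {j} {a} i≤j unsplit = begin
    colourDeg j a a                                   ≡⟨ colourDeg-unsplit i≤j unsplit ⟩
    bit (adj G a a) + bit (adj G a a′)                ≡⟨ cong₂ (λ x y → bit x + bit y) (Graph.irrefl G a) (Graph.sym G a a′) ⟩
    bit (adj G a′ a)                                  ≡⟨ +-identityʳ _ ⟨
    bit (adj G a′ a) + 0                              ≡⟨ cong (λ x → bit (adj G a′ a) + bit x) (Graph.irrefl G a′) ⟨
    bit (adj G a′ a) + bit (adj G a′ a′)              ≡⟨ colourDeg-unsplit i≤j unsplit ⟨
    colourDeg j a′ a                                  ∎
    where
      open ≡-Reasoning
      a′ = partner a

  late⇒¬IsMin : ∀ {a} → Unsplit (suc i) a → ¬ IsMin G i a
  late⇒¬IsMin a-late minimal =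
    let (u , u-splits) = some-pair-splits ≤-refl (<-trans (n<1+n i) (Unsplit⇒<N a-late))
    in minimal (u , ⇒prec (proj₂ u-splits) a-late)

  first⇒IsMin : ∀ {a} → ¬ Unsplit (suc i) a → IsMin G i a
  first⇒IsMin {a} a-split (q , q≺a) =
    let (j , q-split , a-unsplit) = prec⇒ q≺a
    in q-split (Unsplit-early q (s≤s⁻¹ (Unsplit-before-split a-unsplit a-split)))

  module _ (deg≤3 : ∀ v → deg G v ≤ 3) where

    no-room-for-late-pair : ∀ {e q c r t s} → SplitAt t c → SplitAt s r → t < s → Unsplit (suc s) q →
      adj G e q ≡ true → adj G e (partner q) ≡ true → adj G e c ≡ true → adj G e r ≡ true → ⊥
    no-room-for-late-pair {e} {q} {c} {r} (_ , c-split) (r-unsplit , r-split) t<s q-unsplit eq eq′ ec er =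
      1+n≰n (≤-trans (length≤count (adj G e) (q ∷ partner q ∷ c ∷ r ∷ []) distinct (eq ∷ eq′ ∷ ec ∷ er ∷ []))
                     (deg≤3 e))
      where
        q′-unsplit = Unsplit-pairmate (∼-partner q) q-unsplit
        distinct : Unique (q ∷ partner q ∷ c ∷ r ∷ [])
        distinct = (≢-sym (partner-≢ q)
                     ∷ Unsplit≢Split (∼-mono (m≤n⇒m≤1+n t<s) q-unsplit) c-split
                     ∷ Unsplit≢Split q-unsplit r-split ∷ [])
                 ∷ (Unsplit≢Split (∼-mono (m≤n⇒m≤1+n t<s) q′-unsplit) c-split
                     ∷ Unsplit≢Split q′-unsplit r-split ∷ [])
                 ∷ (≢-sym (Unsplit≢Split (∼-mono t<s r-unsplit) c-split) ∷ [])
                 ∷ [] ∷ []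

    no-edge-to-late-pair : ∀ {a c u q t} → i ≤ t → SplitAt (suc t) a → SplitAt t c → adj G a c ≢ adj G (partner a) c →
                           SplitAt (suc (suc t)) u → Unsplit (suc (suc (suc t))) q → ¬ PairEdge G i a q
    no-edge-to-late-pair {a} {c} {u} {q} {t} i≤t a-splits c-splits a-c-differ u-splits q-unsplit (x , y , a∼x , q∼y , xy) =
      [ (λ ac → overloaded (∼-refl a) a-sees-q ac (proj₁ sees-u-pair))
      , (λ a′c → overloaded (∼-partner a) (trans (sym same-rows) a-sees-q) a′c (proj₂ sees-u-pair))
      ]′ (≢-true a-c-differ)
      where
        open ≡-Reasoning
        a′ = partner a
        q′ = partner q
        sees-u-pair : adj G a u ≢ adj G a (partner u) × adj G a′ u ≢ adj G a′ (partner u)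
        sees-u-pair = split-pair-sees-cause-oppositely a-splits u-splits
        a-alike : ∀ {e} → a ∼[ i ] e → adj G e q ≡ adj G e q′
        a-alike a∼e = split-vertex-sees-pair-alike (m≤n⇒m≤1+n (m≤n⇒m≤1+n i≤t))
                        (Split-pairmate a∼e (proj₂ a-splits)) q-unsplit
        same-rows : adj G a q ≡ adj G a′ q
        same-rows = bit-injective (double-injective (begin
          bit (adj G a q) + bit (adj G a q)       ≡⟨ cong (λ b → bit (adj G a q) + bit b) (a-alike (∼-refl a)) ⟩
          bit (adj G a q) + bit (adj G a q′)
            ≡⟨ pair-balance i≤t (proj₁ a-splits) (∼-mono (m≤n⇒m≤1+n (n≤1+n t)) (∼-pred q-unsplit)) ⟩
          bit (adj G a′ q) + bit (adj G a′ q′)    ≡⟨ cong (λ b → bit (adj G a′ q) + bit b) (a-alike (∼-partner a)) ⟨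
          bit (adj G a′ q) + bit (adj G a′ q)     ∎))
        a-sees-q : adj G a q ≡ true
        a-sees-q with pair-members (mk∼ a∼x) | pair-members (mk∼ q∼y)
        ... | inj₁ refl | inj₁ refl = xy
        ... | inj₁ refl | inj₂ refl = trans (a-alike (∼-refl a)) xy
        ... | inj₂ refl | inj₁ refl = trans same-rows xy
        ... | inj₂ refl | inj₂ refl = trans same-rows (trans (a-alike (∼-partner a)) xy)
        t<2+t : t < suc (suc t)
        t<2+t = <-trans (n<1+n t) (n<1+n (suc t))
        overloaded : ∀ {e} → a ∼[ i ] e → adj G e q ≡ true → adj G e c ≡ true → adj G e u ≢ adj G e (partner u) → ⊥
        overloaded a∼e eq ec differs with ≢-true differs
        ... | inj₁ eu = no-room-for-late-pair c-splits u-splits t<2+t q-unsplit eq (trans (sym (a-alike a∼e)) eq) ec eu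
        ... | inj₂ eu′ = no-room-for-late-pair c-splits (SplitAt-pairmate (∼-partner u) u-splits) t<2+t
                           q-unsplit eq (trans (sym (a-alike a∼e)) eq) ec eu′

    later-pairs-unreached : ∀ {a q} → Unsplit (suc i) a → SuccPrec G a q → ¬ PairEdge G i a q
    later-pairs-unreached {a} {q} a-late q-later with late-split-time a-late
    ... | t , i≤t , a-splits =
      let (c , c-splits , a-c-differ) = split-cause i≤t a-splits
          q-unsplit : Unsplit (suc (suc (suc t))) q
          q-unsplit = SuccPrec⇒Unsplit a-splits q-later
          (u , u-splits) = some-pair-splits (m≤n⇒m≤1+n (m≤n⇒m≤1+n i≤t)) (<⇒≤ (Unsplit⇒<N q-unsplit))
      in no-edge-to-late-pair i≤t a-splits c-splits a-c-differ u-splits q-unsplit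

module FirstSplitPair {N : ℕ} (G : Graph (suc N)) (long : LongRefinement G) (i₀ : ℕ)
                      (pairs : AllPairs G (suc i₀)) (deg≤3 : ∀ v → deg G v ≤ 3) where
  open ColourRefinement G
  open LongRefinementGraph G long
  open SplittingPairs G long (suc i₀) pairs

  i : ℕ
  i = suc i₀

  module _ {a : Fin (suc N)} (a-first : ¬ Unsplit (suc i) a) where

    a′ : Fin (suc N)
    a′ = partner a

    a-splits : SplitAt i a
    a-splits = Unsplit-early a ≤-refl , a-first

    i₀<N : i₀ < N
    i₀<N = <-trans (n<1+n i₀) (Unsplit⇒<N (proj₁ a-splits))

    pair-sees-own-class-alike : ∀ {y} → a ∼[ i ] y → colourDeg i a y ≡ colourDeg i a′ y
    pair-sees-own-class-alike {y} a∼y = begin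
      colourDeg i a y    ≡⟨ colourDeg-congʳ a (∼-sym a∼y) ⟩
      colourDeg i a a    ≡⟨ pair-views-itself-alike ≤-refl (proj₁ a-splits) ⟩
      colourDeg i a′ a   ≡⟨ colourDeg-congʳ a′ a∼y ⟩
      colourDeg i a′ y   ∎
      where open ≡-Reasoning

    module _ {w : Fin (suc N)} (w-separates : colourDeg i a w ≢ colourDeg i a′ w) where

      w-balanced-before : colourDeg i₀ a w ≡ colourDeg i₀ a′ w
      w-balanced-before = proj₂ (∼-suc⇒ (proj₁ a-splits)) w

      -- Had the class of w survived round i, a and a′ would still see it alike.
      w-class-refined : ∃[ z ] (z ∼[ i₀ ] w × ¬ z ∼[ i ] w)
      w-class-refined
        with ¬∀⟶∃¬ _ (λ x → x ∼[ i₀ ] w → x ∼[ i ] w) (λ x → ∼? i₀ x w →-dec ∼? i x w) unrefined-impossible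
        where
          unrefined-impossible : ¬ (∀ x → x ∼[ i₀ ] w → x ∼[ i ] w)
          unrefined-impossible kept = w-separates (begin
            colourDeg i a w    ≡⟨ colourDeg-cong a ∼-pred (kept _) ⟩
            colourDeg i₀ a w   ≡⟨ w-balanced-before ⟩
            colourDeg i₀ a′ w  ≡⟨ colourDeg-cong a′ (kept _) ∼-pred ⟩
            colourDeg i a′ w   ∎)
            where open ≡-Reasoning
      ... | z , ¬kept with ∼? i₀ z w
      ...   | yes z∼w = z , z∼w , λ z∼′w → ¬kept (λ _ → z∼′w)
      ...   | no z≁w = ⊥-elim (¬kept (λ z∼w → ⊥-elim (z≁w z∼w)))

      module _ {z : Fin (suc N)} (z∼w : z ∼[ i₀ ] w) (z≁w : ¬ z ∼[ i ] w) where

        class-of-w : ∀ {x} → x ∼[ i₀ ] w → x ∼[ i ] w ⊎ x ∼[ i ] z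
        class-of-w {x} x∼w with ∼? i x w
        ... | yes x∼′w = inj₁ x∼′w
        ... | no x≁w = inj₂ (∼-sym (class-splits-in-two i₀<N (∼-sym z∼w) (∼-sym x∼w)
                               (z≁w ∘ ∼-sym) (x≁w ∘ ∼-sym)))

        apart : ∀ {x y} → w ∼[ i ] x → z ∼[ i ] y → x ≢ y
        apart w∼x z∼y refl = z≁w (∼-trans z∼y (∼-sym w∼x))

        colourDeg-w-class : ∀ v → colourDeg i₀ v w ≡ colourDeg i v w + colourDeg i v z
        colourDeg-w-class v = begin
          colourDeg i₀ v w
            ≡⟨ count-sum _ (w ∷ w′ ∷ z ∷ z′ ∷ []) distinct support ⟩
          bit (adj G v w ∧ sameCol G i₀ w w) + (bit (adj G v w′ ∧ sameCol G i₀ w′ w)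
            + (bit (adj G v z ∧ sameCol G i₀ z w) + (bit (adj G v z′ ∧ sameCol G i₀ z′ w) + 0)))
            ≡⟨ cong₂ _+_ (in-class (∼-refl w)) (cong₂ _+_ (in-class (∼-sym (∼-pred (∼-partner w))))
                 (cong₂ _+_ (in-class z∼w) (trans (+-identityʳ _) (in-class (∼-trans (∼-sym (∼-pred (∼-partner z))) z∼w))))) ⟩
          bit (adj G v w) + (bit (adj G v w′) + (bit (adj G v z) + bit (adj G v z′)))
            ≡⟨ +-assoc (bit (adj G v w)) _ _ ⟨
          (bit (adj G v w) + bit (adj G v w′)) + (bit (adj G v z) + bit (adj G v z′))
            ≡⟨ cong₂ _+_ (colourDeg-unsplit ≤-refl (∼-partner w)) (colourDeg-unsplit ≤-refl (∼-partner z)) ⟨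
          colourDeg i v w + colourDeg i v z ∎
          where
            open ≡-Reasoning
            w′ = partner w
            z′ = partner z
            in-class : ∀ {x} → x ∼[ i₀ ] w → bit (adj G v x ∧ sameCol G i₀ x w) ≡ bit (adj G v x)
            in-class {x} x∼w = cong bit (trans (cong (adj G v x ∧_) (holds x∼w)) (∧-identityʳ _))
            distinct : Unique (w ∷ w′ ∷ z ∷ z′ ∷ [])
            distinct = (≢-sym (partner-≢ w) ∷ apart (∼-refl w) (∼-refl z) ∷ apart (∼-refl w) (∼-partner z) ∷ [])
                     ∷ (apart (∼-partner w) (∼-refl z) ∷ apart (∼-partner w) (∼-partner z) ∷ [])
                     ∷ (≢-sym (partner-≢ z) ∷ [])
                     ∷ [] ∷ []
            support : ∀ x → adj G v x ∧ sameCol G i₀ x w ≡ true → x ∈ w ∷ w′ ∷ z ∷ z′ ∷ []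
            support x e with class-of-w (mk∼ (∧-elimʳ {adj G v x} e))
            ... | inj₁ x∼w with pair-members (∼-sym x∼w)
            ...   | inj₁ x≡w = here x≡w
            ...   | inj₂ x≡w′ = there (here x≡w′)
            support x e | inj₂ x∼z with pair-members (∼-sym x∼z)
            ...   | inj₁ x≡z = there (there (here x≡z))
            ...   | inj₂ x≡z′ = there (there (there (here x≡z′)))

        z-seen-differently : colourDeg i a z ≢ colourDeg i a′ z
        z-seen-differently same = w-separates (+-cancelʳ-≡ (colourDeg i a z) _ _ (begin
          colourDeg i a w + colourDeg i a z    ≡⟨ colourDeg-w-class a ⟨
          colourDeg i₀ a w                     ≡⟨ w-balanced-before ⟩
          colourDeg i₀ a′ w                    ≡⟨ colourDeg-w-class a′ ⟩
          colourDeg i a′ w + colourDeg i a′ z  ≡⟨ cong (colourDeg i a′ w +_) same ⟨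
          colourDeg i a′ w + colourDeg i a z   ∎))
          where open ≡-Reasoning

        a-outside : ¬ a ∼[ i₀ ] w
        a-outside a∼w with class-of-w a∼w
        ... | inj₁ a∼′w = w-separates (pair-sees-own-class-alike a∼′w)
        ... | inj₂ a∼z = z-seen-differently (pair-sees-own-class-alike a∼z)

        w-late : Unsplit (suc i) w
        w-late with ∼? (suc i) w (partner w)
        ... | yes unsplit = unsplit
        ... | no split = ⊥-elim (a-outside (∼-sym (∼-pred (one-pair-splits (∼-partner w , split) a-splits))))

        z-late : Unsplit (suc i) z
        z-late with ∼? (suc i) z (partner z)
        ... | yes unsplit = unsplit
        ... | no split = ⊥-elim (a-outside (∼-trans (∼-sym (∼-pred (one-pair-splits (∼-partner z , split) a-splits))) z∼w))

        module _ {u : Fin (suc N)} (u-splits : SplitAt (suc i) u) where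

          sees-u-pair-once : ∀ {e} → a ∼[ i ] e → adj G e u ≢ adj G e (partner u)
          sees-u-pair-once a∼e with pair-members a∼e
          ... | inj₁ refl = proj₁ (split-pair-sees-cause-oppositely a-splits u-splits)
          ... | inj₂ refl = proj₂ (split-pair-sees-cause-oppositely a-splits u-splits)

          views-u-class-once : ∀ {e X} → a ∼[ i ] e → X ∼[ i ] u → colourDeg i e X ≡ 1
          views-u-class-once {e} a∼e X∼u =
            trans (colourDeg-congʳ e X∼u)
                  (trans (colourDeg-unsplit ≤-refl (∼-partner u)) (bits-differ-sum (sees-u-pair-once a∼e)))

          u-outside : ¬ u ∼[ i₀ ] w
          u-outside u∼w with class-of-w u∼w
          ... | inj₁ u∼′w = w-separates (trans (views-u-class-once (∼-refl a) (∼-sym u∼′w))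
                                               (sym (views-u-class-once (∼-partner a) (∼-sym u∼′w))))
          ... | inj₂ u∼z = z-seen-differently (trans (views-u-class-once (∼-refl a) (∼-sym u∼z))
                                                     (sym (views-u-class-once (∼-partner a) (∼-sym u∼z))))

          stays-unsplit : ∀ {X} → Unsplit (suc i) X → ¬ X ∼[ i ] u → Unsplit (suc (suc i)) X
          stays-unsplit {X} X-late X≁u with ∼? (suc (suc i)) X (partner X)
          ... | yes unsplit = unsplit
          ... | no split = ⊥-elim (X≁u (one-pair-splits (X-late , split) u-splits))

          w-later : Unsplit (suc (suc i)) w
          w-later = stays-unsplit w-late (λ w∼u → u-outside (∼-sym (∼-pred w∼u)))

          z-later : Unsplit (suc (suc i)) z
          z-later = stays-unsplit z-late (λ z∼u → u-outside (∼-trans (∼-sym (∼-pred z∼u)) z∼w))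

          sees-late-pair-uniformly : ∀ {e X y} → a ∼[ i ] e → Unsplit (suc (suc i)) X → X ∼[ i ] y →
                                     adj G e y ≡ adj G e X
          sees-late-pair-uniformly a∼e X-later X∼y with pair-members X∼y
          ... | inj₁ refl = refl
          ... | inj₂ refl = sym (split-vertex-sees-pair-alike (n≤1+n i) (Split-pairmate a∼e a-first) X-later)

          doubled-view : ∀ {e X} → a ∼[ i ] e → Unsplit (suc (suc i)) X →
                         colourDeg i e X ≡ bit (adj G e X) + bit (adj G e X)
          doubled-view {e} {X} a∼e X-later =
            trans (colourDeg-unsplit ≤-refl (∼-partner X))
                  (cong (λ b → bit (adj G e X) + bit b) (sees-late-pair-uniformly a∼e X-later (∼-partner X)))

          halved-balance : bit (adj G a w) + bit (adj G a z) ≡ bit (adj G a′ w) + bit (adj G a′ z)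
          halved-balance = double-injective (begin
            (bit (adj G a w) + bit (adj G a z)) + (bit (adj G a w) + bit (adj G a z))
              ≡⟨ interchange (bit (adj G a w)) _ _ _ ⟩
            (bit (adj G a w) + bit (adj G a w)) + (bit (adj G a z) + bit (adj G a z))
              ≡⟨ cong₂ _+_ (doubled-view (∼-refl a) w-later) (doubled-view (∼-refl a) z-later) ⟨
            colourDeg i a w + colourDeg i a z
              ≡⟨ colourDeg-w-class a ⟨
            colourDeg i₀ a w
              ≡⟨ w-balanced-before ⟩
            colourDeg i₀ a′ w
              ≡⟨ colourDeg-w-class a′ ⟩
            colourDeg i a′ w + colourDeg i a′ z
              ≡⟨ cong₂ _+_ (doubled-view (∼-partner a) w-later) (doubled-view (∼-partner a) z-later) ⟩
            (bit (adj G a′ w) + bit (adj G a′ w)) + (bit (adj G a′ z) + bit (adj G a′ z))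
              ≡⟨ interchange (bit (adj G a′ w)) _ _ _ ⟩
            (bit (adj G a′ w) + bit (adj G a′ z)) + (bit (adj G a′ w) + bit (adj G a′ z)) ∎)
            where open ≡-Reasoning

          w-seen-differently : adj G a w ≢ adj G a′ w
          w-seen-differently same = w-separates (begin
            colourDeg i a w                       ≡⟨ doubled-view (∼-refl a) w-later ⟩
            bit (adj G a w) + bit (adj G a w)     ≡⟨ cong (λ b → bit b + bit b) same ⟩
            bit (adj G a′ w) + bit (adj G a′ w)   ≡⟨ doubled-view (∼-partner a) w-later ⟨
            colourDeg i a′ w                      ∎)
            where open ≡-Reasoning

          late-neighbours-beside-split-in-pair : ∀ {e X g y} → a ∼[ i ] e → adj G e X ≡ true → Unsplit (suc (suc i)) X →
                                   adj G e g ≡ true → ¬ Unsplit (suc (suc i)) g →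
                                   adj G e y ≡ true → Unsplit (suc (suc i)) y → X ∼[ i ] y
          late-neighbours-beside-split-in-pair {e} {X} {g} {y} a∼e eX X-later eg g-split ey y-later
            with count-within (adj G e) (X ∷ partner X ∷ g ∷ [])
                   ((≢-sym (partner-≢ X) ∷ Unsplit≢Split X-later g-split ∷ [])
                     ∷ (Unsplit≢Split (Unsplit-pairmate (∼-partner X) X-later) g-split ∷ []) ∷ [] ∷ [])
                   (eX ∷ trans (sees-late-pair-uniformly a∼e X-later (∼-partner X)) eX ∷ eg ∷ []) (deg≤3 e) y ey
          ... | here refl = ∼-refl X
          ... | there (here refl) = ∼-partner X
          ... | there (there (here refl)) = ⊥-elim (g-split y-later)

          late-neighbours-in-pair : ∀ {e X y} → a ∼[ i ] e → adj G e X ≡ true → Unsplit (suc (suc i)) X →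
                                    adj G e y ≡ true → Unsplit (suc (suc i)) y → X ∼[ i ] y
          late-neighbours-in-pair a∼e eX X-later with ≢-true (sees-u-pair-once a∼e)
          ... | inj₁ eu = late-neighbours-beside-split-in-pair a∼e eX X-later eu (proj₂ u-splits)
          ... | inj₂ eu′ = late-neighbours-beside-split-in-pair a∼e eX X-later eu′ (Split-pairmate (∼-partner u) (proj₂ u-splits))

          other-member : ∀ {v} → a ∼[ i ] v → v ≢ a → v ≡ a′
          other-member a∼v v≢a with pair-members a∼v
          ... | inj₁ v≡a = ⊥-elim (v≢a v≡a)
          ... | inj₂ v≡a′ = v≡a′

          caseB-from : ∀ {X Y} → ¬ X ∼[ i ] Y → Unsplit (suc (suc i)) X → Unsplit (suc (suc i)) Y →
                       adj G a X ≡ true → adj G a Y ≡ false → adj G a′ Y ≡ true → adj G a′ X ≡ false → CaseB G i a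
          caseB-from {X} {Y} X≁Y X-later Y-later aX aY a′Y a′X =
            first⇒IsMin a-first , X , Y , (λ X∼Y → X≁Y (mk∼ X∼Y)) ,
            reached X-later , (a , X , sameCol-refl i a , sameCol-refl i X , aX) ,
            reached Y-later , (a′ , Y , holds (∼-partner a) , sameCol-refl i Y , a′Y) ,
            covered ,
            a , sameCol-refl i a ,
            (λ y X∼y → trans (uniform (∼-refl a) X-later X∼y) aX) ,
            (λ v y a∼v v≢a Y∼y → subst (λ v → adj G v y ≡ true) (sym (other-member (mk∼ a∼v) v≢a))
                                   (trans (uniform (∼-partner a) Y-later Y∼y) a′Y)) ,
            (λ y Y∼y → trans (uniform (∼-refl a) Y-later Y∼y) aY) ,
            (λ v y a∼v v≢a X∼y → subst (λ v → adj G v y ≡ false) (sym (other-member (mk∼ a∼v) v≢a))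
                                   (trans (uniform (∼-partner a) X-later X∼y) a′X))
            where
              reached : ∀ {Q} → Unsplit (suc (suc i)) Q → SuccPrec G a Q
              reached Q-later = u , ⇒prec a-first (proj₁ u-splits) , ⇒prec (proj₂ u-splits) Q-later
              uniform : ∀ {e Q y} → a ∼[ i ] e → Unsplit (suc (suc i)) Q → sameCol G i Q y ≡ true →
                        adj G e y ≡ adj G e Q
              uniform a∼e Q-later Q∼y = sees-late-pair-uniformly a∼e Q-later (mk∼ Q∼y)
              via : ∀ {e Q q y} → a ∼[ i ] e → adj G e Q ≡ true → Unsplit (suc (suc i)) Q →
                    SuccPrec G a q → sameCol G i q y ≡ true → adj G e y ≡ true → InPair G i Q q
              via a∼e eQ Q-later q-later q∼y ey = holds (∼-trans
                (late-neighbours-in-pair a∼e eQ Q-later ey (Unsplit-pairmate (mk∼ q∼y) (SuccPrec⇒Unsplit a-splits q-later)))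
                (∼-sym (mk∼ q∼y)))
              covered : ∀ q → SuccPrec G a q → PairEdge G i a q → InPair G i X q ⊎ InPair G i Y q
              covered q q-later (x , y , a∼x , q∼y , xy) with pair-members (mk∼ a∼x)
              ... | inj₁ refl = inj₁ (via (∼-refl a) aX X-later q-later q∼y xy)
              ... | inj₂ refl = inj₂ (via (∼-partner a) a′Y Y-later q-later q∼y xy)

          first-pair-structure : CaseB G i a
          first-pair-structure = orient (adj G a w) refl
            where
              a′w≡not-aw : adj G a′ w ≡ not (adj G a w)
              a′w≡not-aw = ¬-not (≢-sym w-seen-differently)
              opposite : adj G a z ≡ adj G a′ w × adj G a′ z ≡ adj G a w
              opposite = opposite-bits _ _ _ _ halved-balance w-seen-differently
              orient : ∀ b → adj G a w ≡ b → CaseB G i a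
              orient true aw =
                caseB-from (z≁w ∘ ∼-sym) w-later z-later
                  aw (trans (proj₁ opposite) a′w-false) (trans (proj₂ opposite) aw) a′w-false
                where a′w-false = trans a′w≡not-aw (cong not aw)
              orient false aw =
                caseB-from z≁w z-later w-later
                  (trans (proj₁ opposite) a′w-true) aw a′w-true (trans (proj₂ opposite) aw)
                where a′w-true = trans a′w≡not-aw (cong not aw)

  first-pair-caseB : ∀ {a} → ¬ Unsplit (suc i) a → CaseB G i a
  first-pair-caseB {a} a-first =
    let (w , w-separates) = refines-at (proj₁ (a-splits a-first)) a-first
        (z , z∼w , z≁w) = w-class-refined a-first w-separates
        next : ∃[ u ] SplitAt (suc i) u
        next = some-pair-splits (n≤1+n i) (Unsplit⇒<N (w-late a-first w-separates z∼w z≁w))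
    in first-pair-structure a-first w-separates z∼w z≁w (proj₂ next)

DegSet23⇒deg≤3 : ∀ {n} (G : Graph n) → DegSet23 G → ∀ v → deg G v ≤ 3
DegSet23⇒deg≤3 G (degs , _) v with degs v
... | inj₁ deg≡2 = ≤-trans (≤-reflexive deg≡2) (n≤1+n 2)
... | inj₂ deg≡3 = ≤-reflexive deg≡3

-- Initially all vertices share one colour, so pairs at round 0 would mean two vertices, too few for degree 3.
DegSet23⇒¬AllPairs₀ : ∀ {n} (G : Graph n) → DegSet23 G → ¬ AllPairs G 0
DegSet23⇒¬AllPairs₀ G (_ , _ , v , deg≡3) pairs =
  1+n≰n (≤-trans (≤-reflexive (sym deg≡3))
                 (≤-trans (count-≤ (adj G v)) (≤-reflexive (trans (sym count-true) (pairs v)))))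

lemma17 : {n : ℕ} (G : Graph n) → LongRefinement G → DegSet23 G →
          (i : ℕ) → AllPairs G i → (p1 : Fin n) →
          (CaseA G i p1 ⊎ CaseB G i p1) × ¬ (CaseA G i p1 × CaseB G i p1)
lemma17 G long degs zero pairs p1 = ⊥-elim (DegSet23⇒¬AllPairs₀ G degs pairs)
lemma17 {suc N} G long degs (suc i₀) pairs p1 = dichotomy , λ (A , B) → proj₁ A (proj₁ B)
  where
    open ColourRefinement G using (∼?)
    open SplittingPairs G long (suc i₀) pairs
    dichotomy : CaseA G (suc i₀) p1 ⊎ CaseB G (suc i₀) p1
    dichotomy with ∼? (suc (suc i₀)) p1 (partner p1)
    ... | yes late = inj₁ (late⇒¬IsMin late , λ _ → later-pairs-unreached (DegSet23⇒deg≤3 G degs) late)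
    ... | no first = inj₂ (FirstSplitPair.first-pair-caseB G long i₀ pairs (DegSet23⇒deg≤3 G degs) first)
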